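{- For all integers $k\ge 2$, $d\ge 0$ and $n\ge 1$, there exists an oriented graph on $n$ vertices with minimum semidegree $d$ and no directed cycle of length at most $k$ if and only if there exists a bipartite graph $G$ on $2n$ vertices with minimum degree $\delta(G)=d+1$ such that the $k$-switch graph $\mathcal H_k(G)$ has an isolated vertex.
   Context: For a graph $G$ and an integer $k\ge 2$, the $k$-switch graph $\mathcal H_k(G)$ is the graph whose vertex set is the set of perfect matchings of $G$, two distinct perfect matchings $M_1,M_2$ being adjacent iff $|M_1\,\Delta\,M_2|\le 2k$. An oriented graph is a directed graph with no loops and no pair of opposite arcs. The minimum semidegree of a digraph is the minimum, over all vertices $v$, of $\min\{\deg^+(v),\deg^-(v)\}$. -}

module Defs where

open import Data.Nat using (ℕ; zero; suc; _+_; _*_; _≤_; _<_)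
open import Data.Bool using (Bool; true; false; if_then_else_; _xor_; _∧_)
open import Data.Fin using (Fin; zero; suc; inject₁; fromℕ; toℕ)
import Data.Fin as F
open import Data.Product using (Σ; ∃; _×_; _,_)
open import Data.Sum using (_⊎_)
open import Data.Empty using (⊥)
open import Relation.Binary.PropositionalEquality using (_≡_; _≢_)
open import Relation.Nullary.Decidable using (⌊_⌋)
open import Function.Definitions using (Injective)

count : {n : ℕ} → (Fin n → Bool) → ℕ
count {zero}  p = 0
count {suc n} p = (if p zero then 1 else 0) + count (λ i → p (suc i))

sumFin : {n : ℕ} → (Fin n → ℕ) → ℕ
sumFin {zero}  f = 0
sumFin {suc n} f = f zero + sumFin (λ i → f (suc i))

-- a digraph on Fin n is given by its arc relation (A u v ≡ true : arc u → v)
Digraph : ℕ → Set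
Digraph n = Fin n → Fin n → Bool

IsOriented : {n : ℕ} → Digraph n → Set
IsOriented {n} A =
  (∀ (v : Fin n) → A v v ≡ false) ×
  (∀ (u v : Fin n) → A u v ≡ true → A v u ≡ false)

outdeg : {n : ℕ} → Digraph n → Fin n → ℕ
outdeg A u = count (λ v → A u v)

indeg : {n : ℕ} → Digraph n → Fin n → ℕ
indeg A v = count (λ u → A u v)

MinSemidegree : {n : ℕ} → Digraph n → ℕ → Set
MinSemidegree {n} A d =
  (∀ (v : Fin n) → (d ≤ outdeg A v) × (d ≤ indeg A v)) ×
  (∃ λ (v : Fin n) → (outdeg A v ≡ d) ⊎ (indeg A v ≡ d))

-- a directed cycle of length (suc m): distinct vertices c 0, …, c m with
-- arcs c i → c (i+1) and c m → c 0
DirectedCycle : {n : ℕ} → Digraph n → (m : ℕ) → Set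
DirectedCycle {n} A m =
  Σ (Fin (suc m) → Fin n) λ c →
    Injective _≡_ _≡_ c ×
    (∀ (i : Fin m) → A (c (inject₁ i)) (c (suc i)) ≡ true) ×
    (A (c (fromℕ m)) (c zero) ≡ true)

NoShortCycle : {n : ℕ} → Digraph n → ℕ → Set
NoShortCycle A k = ∀ (m : ℕ) → suc m ≤ k → DirectedCycle A m → ⊥

record Graph (m : ℕ) : Set where
  field
    adj   : Fin m → Fin m → Bool
    sym   : ∀ u v → adj u v ≡ adj v u
    irrefl : ∀ v → adj v v ≡ false
open Graph public

deg : {m : ℕ} → Graph m → Fin m → ℕ
deg G v = count (λ u → adj G v u)

IsBipartite : {m : ℕ} → Graph m → Set
IsBipartite {m} G =
  Σ (Fin m → Bool) λ col → ∀ u v → adj G u v ≡ true → col u ≢ col v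

MinDegree : {m : ℕ} → Graph m → ℕ → Set
MinDegree {m} G δ = (∀ (v : Fin m) → δ ≤ deg G v) × (∃ λ (v : Fin m) → deg G v ≡ δ)

IsPerfectMatching : {m : ℕ} → Graph m → (Fin m → Fin m → Bool) → Set
IsPerfectMatching {m} G M =
  (∀ u v → M u v ≡ M v u) ×
  (∀ u v → M u v ≡ true → adj G u v ≡ true) ×
  (∀ (v : Fin m) → count (λ u → M v u) ≡ 1)

symDiffSize : {m : ℕ} → (Fin m → Fin m → Bool) → (Fin m → Fin m → Bool) → ℕ
symDiffSize M₁ M₂ =
  sumFin (λ u → count (λ v → ⌊ u F.<? v ⌋ ∧ (M₁ u v xor M₂ u v)))

-- The k-switch graph H_k(G) has an isolated vertex: some perfect matching M
-- is adjacent to no other perfect matching, i.e. every perfect matching M'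
-- with |M Δ M'| ≤ 2k equals M.
HkHasIsolatedVertex : {m : ℕ} → ℕ → Graph m → Set
HkHasIsolatedVertex {m} k G =
  Σ (Fin m → Fin m → Bool) λ M →
    IsPerfectMatching G M ×
    (∀ M' → IsPerfectMatching G M' → symDiffSize M M' ≤ 2 * k →
       ∀ u v → M u v ≡ M' u v)

{-# OPTIONS --safe #-}

-- Write the vertices of a bipartite graph G carrying a perfect matching M₀ as ℓ i and r i
-- (i : Fin n) with M₀ = {ℓ i r i}, and let D be the digraph on Fin n with an arc i → j whenever
-- j ≢ i and ℓ i r j is an edge. Then deg (ℓ i) = 1 + outdeg i and deg (r j) = 1 + indeg j.
-- The perfect matchings of G are the sets {ℓ i r (σ i)} for the permutations σ whose nontrivial
-- cycles are directed cycles of D, and such a matching differs from M₀ in exactly twice as many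
-- edges as σ has moved points. Hence M₀ is isolated in H_k(G) iff D has no directed cycle of
-- length 2, …, k (which for k ≥ 2 makes D oriented), and every loopless digraph A arises as D,
-- from the graph with edges ℓ i r i and ℓ i r j for the arcs i → j of A.

module Submission where

open import Defs hiding (sym)
open import Data.Nat using (ℕ; suc; _+_; _*_; _≤_)
open import Data.Product using (Σ; _×_)
open import Function.Bundles using (_⇔_)

open import Data.Bool using (Bool; true; false; if_then_else_; not; _∧_; _∨_; _xor_)
open import Data.Bool.Properties
  using (¬-not; ∧-comm; ∧-conicalˡ; ∧-identityʳ; ∧-zeroʳ; xor-is-ok; xor-same)
open import Data.Empty using (⊥; ⊥-elim)
open import Data.Fin using (Fin; zero; suc; toℕ; fromℕ; inject₁; _↑ˡ_; _↑ʳ_; splitAt; _≟_; _<?_)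
import Data.Fin.Properties as Finₚ
open import Data.Fin.Properties using (+↔⊎; splitAt-↑ˡ; splitAt-↑ʳ)
import Data.Fin.Relation.Unary.Top as Top
open Top using (‵fromℕ; ‵inject₁)
open import Data.Maybe using (is-just)
open import Data.Nat using (zero; _∸_; _<_; z≤n; s≤s; s≤s⁻¹; _≤?_)
open import Data.Nat.GeneralisedArithmetic using (fold; fold-+)
open import Data.Nat.Properties hiding (_≟_; _<?_)
open import Algebra.Properties.CommutativeSemigroup +-commutativeSemigroup using (interchange)
open import Data.Product using (∃; _,_; proj₁; proj₂)
open import Data.Sum using (_⊎_; inj₁; inj₂; [_,_]′; reduce; isInj₁)
import Data.Sum.Properties as Sumₚ
open import Function using (_∘_; id; Injective; Inverse; Injection; _↔_; mk⇔; mk↔ₛ′)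
open import Function.Construct.Composition using (_↔-∘_)
open import Function.Properties.Inverse using (↔-sym; ↔⇒↣)
open import Relation.Binary.Definitions using (tri<; tri≈; tri>)
open import Relation.Binary.PropositionalEquality
open import Relation.Nullary using (¬_; Dec; yes; no; does; contradiction)
open import Relation.Nullary.Decidable using (⌊_⌋; isYes≗does; dec-true; dec-false; does-⇔)

private
  variable
    a b m n : ℕ

does⇒ : {A : Set} (a? : Dec A) → does a? ≡ true → A
does⇒ (yes a) _ = a

_==_ : Fin n → Fin n → Bool
i == j = does (i ≟ j)

==-refl : (i : Fin n) → (i == i) ≡ true
==-refl i = dec-true (i ≟ i) refl

==-false : {i j : Fin n} → i ≢ j → (i == j) ≡ false
==-false {i = i} {j} = dec-false (i ≟ j)

==⇒≡ : {i j : Fin n} → (i == j) ≡ true → i ≡ j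
==⇒≡ {i = i} {j} = does⇒ (i ≟ j)

==-sym : (i j : Fin n) → (i == j) ≡ (j == i)
==-sym i j = does-⇔ (mk⇔ sym sym) (i ≟ j) (j ≟ i)

-- Counting on Fin

count-cong : {p q : Fin n → Bool} → (∀ x → p x ≡ q x) → count p ≡ count q
count-cong {zero}  _   = refl
count-cong {suc n} p≗q =
  cong₂ _+_ (cong (λ b → if b then 1 else 0) (p≗q zero)) (count-cong (p≗q ∘ suc))

count-mono : {p q : Fin n → Bool} → (∀ x → p x ≡ true → q x ≡ true) → count p ≤ count q
count-mono {zero}          _   = z≤n
count-mono {suc n} {p} {q} p⇒q with p zero in p₀
... | true  rewrite p⇒q zero p₀ = s≤s (count-mono (p⇒q ∘ suc))
... | false = ≤-trans (count-mono (p⇒q ∘ suc)) (m≤n+m _ _)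

count-none : {p : Fin n → Bool} → (∀ x → p x ≡ false) → count p ≡ 0
count-none {zero}  _  = refl
count-none {suc n} ¬p rewrite ¬p zero = count-none (¬p ∘ suc)

count-all : {p : Fin n → Bool} → (∀ x → p x ≡ true) → count p ≡ n
count-all {zero}  _ = refl
count-all {suc n} p rewrite p zero = cong suc (count-all (p ∘ suc))

remove : (Fin n → Bool) → Fin n → Fin n → Bool
remove p a x = p x ∧ not (x == a)

count-remove : (p : Fin n → Bool) {a : Fin n} → p a ≡ true → count p ≡ suc (count (remove p a))
count-remove {suc n} p {zero} pa rewrite pa =
  cong suc (count-cong (λ x → sym (∧-identityʳ (p (suc x)))))
count-remove {suc n} p {suc a} pa rewrite ∧-identityʳ (p zero) =
  trans (cong ((if p zero then 1 else 0) +_) (count-remove (p ∘ suc) pa)) (+-suc _ _)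

remove-true : {p : Fin n → Bool} {a x : Fin n} → p x ≡ true → x ≢ a → remove p a x ≡ true
remove-true px x≢a rewrite px | ==-false x≢a = refl

count-≥2 : {p : Fin n → Bool} {x y : Fin n} → p x ≡ true → p y ≡ true → x ≢ y → 2 ≤ count p
count-≥2 {p = p} {x} px py x≢y
  rewrite count-remove p px | count-remove (remove p x) (remove-true {p = p} py (x≢y ∘ sym)) = s≤s (s≤s z≤n)

count-≤-injection : {p : Fin a → Bool} {q : Fin b → Bool} (f : Fin a → Fin b) →
  (∀ {x y} → p x ≡ true → p y ≡ true → f x ≡ f y → x ≡ y) →
  (∀ {x} → p x ≡ true → q (f x) ≡ true) → count p ≤ count q
count-≤-injection {zero}  _ _ _ = z≤n
count-≤-injection {suc a} {p = p} {q} f f-inj p⇒q with p zero in p₀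
... | false = count-≤-injection (f ∘ suc) (λ px py → Finₚ.suc-injective ∘ f-inj px py) p⇒q
... | true  = begin
  suc (count (p ∘ suc))
    ≤⟨ s≤s (count-≤-injection (f ∘ suc) (λ px py → Finₚ.suc-injective ∘ f-inj px py) q′) ⟩
  suc (count (remove q (f zero)))
    ≡⟨ count-remove q (p⇒q p₀) ⟨
  count q ∎
  where
  open ≤-Reasoning
  q′ : ∀ {x} → p (suc x) ≡ true → remove q (f zero) (f (suc x)) ≡ true
  q′ px = remove-true {p = q} (p⇒q px) (λ e → Finₚ.0≢1+n (f-inj p₀ px (sym e)))

count≡1⇒∃ : {p : Fin n → Bool} → count p ≡ 1 → ∃ λ x → p x ≡ true
count≡1⇒∃ {suc n} {p} c with p zero in p₀
... | true  = zero , p₀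
... | false = let x , px = count≡1⇒∃ c in suc x , px

count≡1⇒unique : {p : Fin n → Bool} → count p ≡ 1 → ∀ {x y} → p x ≡ true → p y ≡ true → x ≡ y
count≡1⇒unique c {x} {y} px py with x ≟ y
... | yes x≡y = x≡y
... | no  x≢y = contradiction (subst (2 ≤_) c (count-≥2 px py x≢y)) λ { (s≤s ()) }

unique⇒count≡1 : {p : Fin n → Bool} {x : Fin n} → p x ≡ true → (∀ {y} → p y ≡ true → y ≡ x) →
  count p ≡ 1
unique⇒count≡1 {p = p} {x} px only-x = trans (count-remove p px) (cong suc (count-none others))
  where
  others : ∀ y → remove p x y ≡ false
  others y with p y in py
  ... | false = refl
  ... | true  rewrite only-x py | ==-refl x = refl

count-split : (p q : Fin n → Bool) → count p ≡ count (λ x → p x ∧ q x) + count (λ x → p x ∧ not (q x))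
count-split {zero}  p q = refl
count-split {suc n} p q with p zero | q zero
... | true  | true  = cong suc (count-split (p ∘ suc) (q ∘ suc))
... | true  | false = trans (cong suc (count-split (p ∘ suc) (q ∘ suc))) (sym (+-suc _ _))
... | false | _     = count-split (p ∘ suc) (q ∘ suc)

count-∨-≤ : (p q : Fin n → Bool) → count (λ x → p x ∨ q x) ≤ count p + count q
count-∨-≤ {zero}  p q = z≤n
count-∨-≤ {suc n} p q with p zero | q zero
... | true  | true  =
  s≤s (≤-trans (count-∨-≤ (p ∘ suc) (q ∘ suc)) (+-monoʳ-≤ (count (p ∘ suc)) (n≤1+n _)))
... | true  | false = s≤s (count-∨-≤ (p ∘ suc) (q ∘ suc))
... | false | true  = ≤-trans (s≤s (count-∨-≤ (p ∘ suc) (q ∘ suc))) (≤-reflexive (sym (+-suc _ _)))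
... | false | false = count-∨-≤ (p ∘ suc) (q ∘ suc)

count-∘-↔ : (ι : Fin a ↔ Fin b) (p : Fin b → Bool) → count (p ∘ Inverse.to ι) ≡ count p
count-∘-↔ ι p = ≤-antisym
  (count-≤-injection to (λ _ _ → Injection.injective (↔⇒↣ ι)) (λ px → px))
  (count-≤-injection from (λ _ _ → Injection.injective (↔⇒↣ (↔-sym ι)))
    (λ {y} py → subst (λ z → p z ≡ true) (sym (strictlyInverseˡ y)) py))
  where open Inverse ι

count-+ : (p : Fin (a + b) → Bool) → count p ≡ count (p ∘ (_↑ˡ b)) + count (p ∘ (a ↑ʳ_))
count-+ {zero}  p = refl
count-+ {suc a} {b} p = trans (cong ((if p zero then 1 else 0) +_) (count-+ {a} {b} (p ∘ suc)))
  (sym (+-assoc (if p zero then 1 else 0) _ _))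

count-⊎ : (ι : Fin m ↔ (Fin a ⊎ Fin b)) (p : Fin m → Bool) →
  count p ≡ count (p ∘ Inverse.from ι ∘ inj₁) + count (p ∘ Inverse.from ι ∘ inj₂)
count-⊎ {a = a} {b} ι p = begin
  count p                                                 ≡⟨ count-∘-↔ (↔-sym ι ↔-∘ +↔⊎) p ⟨
  count (p ∘ from ∘ splitAt a)                            ≡⟨ count-+ {a} {b} (p ∘ from ∘ splitAt a) ⟩
  count (p ∘ from ∘ splitAt a ∘ (_↑ˡ b)) + count (p ∘ from ∘ splitAt a ∘ (a ↑ʳ_))
    ≡⟨ cong₂ _+_ (count-cong (λ i → cong (p ∘ from) (splitAt-↑ˡ a i b)))
                 (count-cong (λ j → cong (p ∘ from) (splitAt-↑ʳ a b j))) ⟩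
  count (p ∘ from ∘ inj₁) + count (p ∘ from ∘ inj₂)       ∎
  where
  open ≡-Reasoning
  open Inverse ι

enum : (p : Fin m → Bool) → Fin (count p) → Fin m
enum {suc m} p i with p zero
enum {suc m} p zero    | true  = zero
enum {suc m} p (suc i) | true  = suc (enum (p ∘ suc) i)
enum {suc m} p i       | false = suc (enum (p ∘ suc) i)

enum-true : (p : Fin m → Bool) (i : Fin (count p)) → p (enum p i) ≡ true
enum-true {suc m} p i with p zero in p₀
enum-true {suc m} p zero    | true  = p₀
enum-true {suc m} p (suc i) | true  = enum-true (p ∘ suc) i
enum-true {suc m} p i       | false = enum-true (p ∘ suc) i

enum-injective : (p : Fin m → Bool) → Injective _≡_ _≡_ (enum p)
enum-injective {suc m} p {i} {j} e with p zero
enum-injective {suc m} p {zero}  {zero}  e | true = refl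
enum-injective {suc m} p {suc i} {suc j} e | true = cong suc (enum-injective (p ∘ suc) (Finₚ.suc-injective e))
enum-injective {suc m} p {i}     {j}     e | false = enum-injective (p ∘ suc) (Finₚ.suc-injective e)

rank : (p : Fin m → Bool) (x : Fin m) → p x ≡ true → Fin (count p)
rank {suc m} p zero    px with p zero
rank {suc m} p zero    px | true  = zero
rank {suc m} p (suc x) px with p zero
rank {suc m} p (suc x) px | true  = suc (rank (p ∘ suc) x px)
rank {suc m} p (suc x) px | false = rank (p ∘ suc) x px

enum-rank : (p : Fin m → Bool) (x : Fin m) (px : p x ≡ true) → enum p (rank p x px) ≡ x
enum-rank {suc m} p zero    px with p zero
enum-rank {suc m} p zero    px | true  = refl
enum-rank {suc m} p (suc x) px with p zero
enum-rank {suc m} p (suc x) px | true  = cong suc (enum-rank (p ∘ suc) x px)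
enum-rank {suc m} p (suc x) px | false = cong suc (enum-rank (p ∘ suc) x px)

rank-enum : (p : Fin m → Bool) (i : Fin (count p)) (px : p (enum p i) ≡ true) → rank p (enum p i) px ≡ i
rank-enum p i px = enum-injective p (enum-rank p (enum p i) px)

rank-cong : (p : Fin m → Bool) {x y : Fin m} → x ≡ y → (px : p x ≡ true) (py : p y ≡ true) →
  rank p x px ≡ rank p y py
rank-cong p {x} refl px py = enum-injective p (trans (enum-rank p x px) (sym (enum-rank p x py)))

-- Sums over Fin and the handshake inequality

sumFin-cong : {f g : Fin n → ℕ} → (∀ x → f x ≡ g x) → sumFin f ≡ sumFin g
sumFin-cong {zero}  _   = refl
sumFin-cong {suc n} f≗g = cong₂ _+_ (f≗g zero) (sumFin-cong (f≗g ∘ suc))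

sumFin-mono : {f g : Fin n → ℕ} → (∀ x → f x ≤ g x) → sumFin f ≤ sumFin g
sumFin-mono {zero}  _   = z≤n
sumFin-mono {suc n} f≤g = +-mono-≤ (f≤g zero) (sumFin-mono (f≤g ∘ suc))

sumFin-distrib-+ : (f g : Fin n → ℕ) → sumFin (λ x → f x + g x) ≡ sumFin f + sumFin g
sumFin-distrib-+ {zero}  f g = refl
sumFin-distrib-+ {suc n} f g =
  trans (cong (f zero + g zero +_) (sumFin-distrib-+ (f ∘ suc) (g ∘ suc))) (interchange (f zero) (g zero) _ _)

sumFin-zero : sumFin {n} (λ _ → 0) ≡ 0
sumFin-zero {zero}  = refl
sumFin-zero {suc n} = sumFin-zero {n}

sumFin-comm : (f : Fin a → Fin b → ℕ) →
  sumFin (λ x → sumFin (f x)) ≡ sumFin (λ y → sumFin (λ x → f x y))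
sumFin-comm {zero}  {b} f = sym (sumFin-zero {b})
sumFin-comm {suc a} f = trans (cong (sumFin (f zero) +_) (sumFin-comm (f ∘ suc)))
                              (sym (sumFin-distrib-+ (f zero) (λ y → sumFin (λ x → f (suc x) y))))

count≡sumFin : (p : Fin n → Bool) → count p ≡ sumFin (λ x → if p x then 1 else 0)
count≡sumFin {zero}  p = refl
count≡sumFin {suc n} p = cong ((if p zero then 1 else 0) +_) (count≡sumFin (p ∘ suc))

*-count≤sumFin : (c : ℕ) (f : Fin n → ℕ) (q : Fin n → Bool) → (∀ x → q x ≡ true → c ≤ f x) →
  c * count q ≤ sumFin f
*-count≤sumFin {zero}  c f q c≤f = ≤-reflexive (*-zeroʳ c)
*-count≤sumFin {suc n} c f q c≤f with q zero in q₀
... | true  = begin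
  c * suc (count (q ∘ suc))
    ≡⟨ *-suc c _ ⟩
  c + c * count (q ∘ suc)
    ≤⟨ +-mono-≤ (c≤f zero q₀) (*-count≤sumFin c (f ∘ suc) (q ∘ suc) (c≤f ∘ suc)) ⟩
  f zero + sumFin (f ∘ suc) ∎
  where open ≤-Reasoning
... | false = ≤-trans (*-count≤sumFin c (f ∘ suc) (q ∘ suc) (c≤f ∘ suc)) (m≤n+m _ _)

sumFin≤*-count : (c : ℕ) (f : Fin n → ℕ) (q : Fin n → Bool) → (∀ x → f x ≤ c) →
  (∀ x → q x ≡ false → f x ≡ 0) → sumFin f ≤ c * count q
sumFin≤*-count {zero}  c f q f≤c f≡0 = z≤n
sumFin≤*-count {suc n} c f q f≤c f≡0 with q zero in q₀
... | true  = begin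
  f zero + sumFin (f ∘ suc)
    ≤⟨ +-mono-≤ (f≤c zero) (sumFin≤*-count c (f ∘ suc) (q ∘ suc) (f≤c ∘ suc) (f≡0 ∘ suc)) ⟩
  c + c * count (q ∘ suc)
    ≡⟨ *-suc c _ ⟨
  c * suc (count (q ∘ suc)) ∎
  where open ≤-Reasoning
... | false rewrite f≡0 zero q₀ = sumFin≤*-count c (f ∘ suc) (q ∘ suc) (f≤c ∘ suc) (f≡0 ∘ suc)

edgeCount : (Fin n → Fin n → Bool) → ℕ
edgeCount T = sumFin (λ u → count (λ v → ⌊ u <? v ⌋ ∧ T u v))

symDiffSize-cong : {M₁ M₂ N₁ N₂ : Fin n → Fin n → Bool} →
  (∀ x y → M₁ x y ≡ N₁ x y) → (∀ x y → M₂ x y ≡ N₂ x y) →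
  symDiffSize M₁ M₂ ≡ symDiffSize N₁ N₂
symDiffSize-cong M₁≗N₁ M₂≗N₂ = sumFin-cong λ u → count-cong λ v →
  cong₂ (λ b c → ⌊ u <? v ⌋ ∧ (b xor c)) (M₁≗N₁ u v) (M₂≗N₂ u v)

edgeCount-transpose : (T : Fin n → Fin n → Bool) → (∀ x y → T x y ≡ T y x) →
  edgeCount T ≡ sumFin (λ x → count (λ y → ⌊ y <? x ⌋ ∧ T x y))
edgeCount-transpose T T-sym = begin
  edgeCount T
    ≡⟨ sumFin-cong (λ x → count≡sumFin (λ y → ⌊ x <? y ⌋ ∧ T x y)) ⟩
  sumFin (λ x → sumFin (indicator x))
    ≡⟨ sumFin-comm indicator ⟩
  sumFin (λ y → sumFin (λ x → indicator x y))
    ≡⟨ sumFin-cong (λ y → count≡sumFin (λ x → ⌊ x <? y ⌋ ∧ T x y)) ⟨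
  sumFin (λ y → count (λ x → ⌊ x <? y ⌋ ∧ T x y))
    ≡⟨ sumFin-cong (λ y → count-cong (λ x → cong (⌊ x <? y ⌋ ∧_) (T-sym x y))) ⟩
  sumFin (λ y → count (λ x → ⌊ x <? y ⌋ ∧ T y x)) ∎
  where
  open ≡-Reasoning
  indicator : Fin _ → Fin _ → ℕ
  indicator x y = if ⌊ x <? y ⌋ ∧ T x y then 1 else 0

handshake-≤ : (T : Fin n → Fin n → Bool) → (∀ x y → T x y ≡ T y x) →
  2 * edgeCount T ≤ sumFin (λ x → count (T x))
handshake-≤ T T-sym = begin
  2 * edgeCount T
    ≡⟨ cong (edgeCount T +_) (trans (+-identityʳ _) (edgeCount-transpose T T-sym)) ⟩
  sumFin above + sumFin below       ≡⟨ sumFin-distrib-+ above below ⟨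
  sumFin (λ x → above x + below x)  ≤⟨ sumFin-mono above+below≤ ⟩
  sumFin (λ x → count (T x))        ∎
  where
  open ≤-Reasoning
  above below : Fin _ → ℕ
  above x = count (λ y → ⌊ x <? y ⌋ ∧ T x y)
  below x = count (λ y → ⌊ y <? x ⌋ ∧ T x y)
  below⇒¬above : ∀ x y → (⌊ y <? x ⌋ ∧ T x y) ≡ true → (T x y ∧ not ⌊ x <? y ⌋) ≡ true
  below⇒¬above x y e with y <? x | x <? y | T x y | e
  ... | yes y<x | yes x<y | _    | _ = contradiction y<x (Finₚ.<-asym x<y)
  ... | yes _   | no _    | true | _ = refl
  above+below≤ : ∀ x → above x + below x ≤ count (T x)
  above+below≤ x = begin
    above x + below x
      ≤⟨ +-mono-≤ (≤-reflexive (count-cong (λ y → ∧-comm ⌊ x <? y ⌋ (T x y))))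
                  (count-mono (below⇒¬above x)) ⟩
    count (λ y → T x y ∧ ⌊ x <? y ⌋) + count (λ y → T x y ∧ not ⌊ x <? y ⌋)
      ≡⟨ count-split (T x) (λ y → ⌊ x <? y ⌋) ⟨
    count (T x) ∎

-- Moved points and cycles of permutations

moved : (Fin n → Fin n) → Fin n → Bool
moved σ x = not (σ x == x)

moved-true : {σ : Fin n → Fin n} {x : Fin n} → σ x ≢ x → moved σ x ≡ true
moved-true σx≢x rewrite ==-false σx≢x = refl

moved⇒≢ : {σ : Fin n → Fin n} {i : Fin n} → moved σ i ≡ true → σ i ≢ i
moved⇒≢ {σ = σ} {i} m σi≡i rewrite dec-true (σ i ≟ i) σi≡i = contradiction m λ ()

¬moved⇒fixed : {σ : Fin n → Fin n} {i : Fin n} → moved σ i ≡ false → σ i ≡ i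
¬moved⇒fixed {σ = σ} {i} ¬m with σ i ≟ i | ¬m
... | yes σi≡i | _ = σi≡i

module Orbit {σ : Fin n → Fin n} (σ-injective : Injective _≡_ _≡_ σ) (x₀ : Fin n) where

  orbit : ℕ → Fin n
  orbit t = fold x₀ σ t

  fold-injective : ∀ t {x y} → fold x σ t ≡ fold y σ t → x ≡ y
  fold-injective zero    e = e
  fold-injective (suc t) e = fold-injective t (σ-injective e)

  orbit-moved : σ x₀ ≢ x₀ → ∀ t → σ (orbit t) ≢ orbit t
  orbit-moved σx₀≢x₀ t e = σx₀≢x₀ (fold-injective t (begin
    fold (σ x₀) σ t  ≡⟨ fold-+ x₀ σ t ⟨
    orbit (t + 1)    ≡⟨ cong orbit (+-comm t 1) ⟩
    σ (orbit t)      ≡⟨ e ⟩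
    orbit t          ∎))
    where open ≡-Reasoning

  NoReturn : ℕ → Set
  NoReturn t = ∀ d → 0 < d → d ≤ t → orbit d ≢ x₀

  no-earlier-repeat : ∀ {t} → NoReturn t → ∀ {a b} → a < b → b ≤ t → orbit a ≢ orbit b
  no-earlier-repeat none {a} {b} a<b b≤t e = none (b ∸ a) (m<n⇒0<n∸m a<b) (≤-trans (m∸n≤m b a) b≤t)
    (fold-injective a (begin
      fold (orbit (b ∸ a)) σ a  ≡⟨ fold-+ x₀ σ a ⟨
      orbit (a + (b ∸ a))       ≡⟨ cong orbit (m+[n∸m]≡n (<⇒≤ a<b)) ⟩
      orbit b                   ≡⟨ e ⟨
      orbit a                   ∎))
    where open ≡-Reasoning

  orbit-injective : ∀ {t} → NoReturn t → ∀ {a b} → a ≤ t → b ≤ t → orbit a ≡ orbit b → a ≡ b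
  orbit-injective none {a} {b} a≤t b≤t e with <-cmp a b
  ... | tri< a<b _ _ = ⊥-elim (no-earlier-repeat none a<b b≤t e)
  ... | tri≈ _ a≡b _ = a≡b
  ... | tri> _ _ b<a = ⊥-elim (no-earlier-repeat none b<a a≤t (sym e))

  firstReturn : ∀ t → (∃ λ L → L < t × orbit (suc L) ≡ x₀ × NoReturn L) ⊎ NoReturn t
  firstReturn zero = inj₂ (λ d 0<d d≤0 → contradiction (n≤0⇒n≡0 d≤0) (>⇒≢ 0<d))
  firstReturn (suc t) with firstReturn t
  ... | inj₁ (L , L<t , back , first) = inj₁ (L , m<n⇒m<1+n L<t , back , first)
  ... | inj₂ none with orbit (suc t) ≟ x₀
  ...   | yes back = inj₁ (t , n<1+n t , back , none)
  ...   | no ¬back = inj₂ none′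
    where
    none′ : NoReturn (suc t)
    none′ d 0<d d≤1+t with m≤n⇒m<n∨m≡n d≤1+t
    ... | inj₁ d<1+t = none d 0<d (s≤s⁻¹ d<1+t)
    ... | inj₂ refl  = ¬back

  orbit-prefix-injective : ∀ {t} → NoReturn t → Injective _≡_ _≡_ (orbit ∘ toℕ {suc t})
  orbit-prefix-injective none =
    Finₚ.toℕ-injective ∘ orbit-injective none (s≤s⁻¹ (Finₚ.toℕ<n _)) (s≤s⁻¹ (Finₚ.toℕ<n _))

  -- The iterates of x₀ are moved points, pairwise distinct until the first return to x₀; so that
  -- return comes within count (moved σ) steps, and the orbit up to it is the cycle.
  orbit-cycle : (A : Digraph n) → (∀ x → σ x ≢ x → A x (σ x) ≡ true) → σ x₀ ≢ x₀ →
    ∃ λ L → suc L ≤ count (moved σ) × DirectedCycle A L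
  orbit-cycle A arcs σx₀≢x₀ with firstReturn (count (moved σ))
  ... | inj₂ none = contradiction too-many 1+n≰n
    where
    too-many : suc (count (moved σ)) ≤ count (moved σ)
    too-many = ≤-trans (≤-reflexive (sym (count-all {p = λ _ → true} (λ _ → refl))))
      (count-≤-injection {p = λ _ → true} (orbit ∘ toℕ) (λ _ _ → orbit-prefix-injective none)
        (λ {i} _ → moved-true {σ = σ} (orbit-moved σx₀≢x₀ (toℕ i))))
  ... | inj₁ (L , L<t , back , first) = L , L<t , orbit ∘ toℕ , orbit-prefix-injective first , c-arcs , c-last
    where
    c-arcs : ∀ (i : Fin L) → A (orbit (toℕ (inject₁ i))) (orbit (suc (toℕ i))) ≡ true
    c-arcs i rewrite Finₚ.toℕ-inject₁ i = arcs _ (orbit-moved σx₀≢x₀ (toℕ i))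
    c-last : A (orbit (toℕ (fromℕ L))) (orbit 0) ≡ true
    c-last rewrite Finₚ.toℕ-fromℕ L =
      subst (λ y → A (orbit L) y ≡ true) back (arcs _ (orbit-moved σx₀≢x₀ L))

cycle-⊆ : {A B : Digraph n} → (∀ i j → A i j ≡ true → B i j ≡ true) →
  ∀ {L} → DirectedCycle A L → DirectedCycle B L
cycle-⊆ A⊆B (c , c-injective , arcs , last) = c , c-injective , (λ i → A⊆B _ _ (arcs i)) , A⊆B _ _ last

2-cycle : {A : Digraph n} {u v : Fin n} → u ≢ v → A u v ≡ true → A v u ≡ true → DirectedCycle A 1
2-cycle {u = u} {v} u≢v uv vu = c , c-injective , (λ { zero → uv }) , vu
  where
  c : Fin 2 → Fin _
  c zero       = u
  c (suc zero) = v
  c-injective : Injective _≡_ _≡_ c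
  c-injective {zero}     {zero}     _ = refl
  c-injective {zero}     {suc zero} e = contradiction e u≢v
  c-injective {suc zero} {zero}     e = contradiction (sym e) u≢v
  c-injective {suc zero} {suc zero} _ = refl

next : ∀ {s} → Fin (suc s) → Fin (suc s)
next t with Top.view t
... | ‵fromℕ      = zero
... | ‵inject₁ t′ = suc t′

prev : ∀ {s} → Fin (suc s) → Fin (suc s)
prev zero    = fromℕ _
prev (suc t) = inject₁ t

prev-next : ∀ {s} (t : Fin (suc s)) → prev (next t) ≡ t
prev-next t with Top.view t
... | ‵fromℕ      = refl
... | ‵inject₁ _  = refl

next-prev : ∀ {s} (t : Fin (suc s)) → next (prev t) ≡ t
next-prev {s} zero rewrite Top.view-fromℕ s = refl
next-prev (suc t) rewrite Top.view-inject₁ t = refl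

cycle-arc : {A : Digraph n} {s : ℕ} → ((c , _) : DirectedCycle A s) → ∀ t → A (c t) (c (next t)) ≡ true
cycle-arc (c , _ , arcs , last) t with Top.view t
... | ‵fromℕ      = last
... | ‵inject₁ t′ = arcs t′

module CyclicShift {s : ℕ} (c : Fin (suc s) → Fin n) (c-injective : Injective _≡_ _≡_ c) where

  OnCycle : Fin n → Set
  OnCycle x = ∃ λ t → c t ≡ x

  onCycle? : ∀ x → Dec (OnCycle x)
  onCycle? x = Finₚ.any? (λ t → c t ≟ x)

  shift : Fin n → Fin n
  shift x with onCycle? x
  ... | yes (t , _) = c (next t)
  ... | no _        = x

  shift-on : ∀ t → shift (c t) ≡ c (next t)
  shift-on t with onCycle? (c t)
  ... | yes (t′ , e) = cong (c ∘ next) (c-injective e)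
  ... | no  off      = contradiction (t , refl) off

  shift-off : ∀ {x} → ¬ OnCycle x → shift x ≡ x
  shift-off {x} off with onCycle? x
  ... | yes on = contradiction on off
  ... | no  _  = refl

  next-injective : ∀ {t u : Fin (suc s)} → next t ≡ next u → t ≡ u
  next-injective {t} {u} e = trans (sym (prev-next t)) (trans (cong prev e) (prev-next u))

  shift-on′ : ∀ {t x} → c t ≡ x → shift x ≡ c (next t)
  shift-on′ {t} refl = shift-on t

  shift-injective : Injective _≡_ _≡_ shift
  shift-injective {x} {y} e = go (onCycle? x) (onCycle? y)
    where
    go : Dec (OnCycle x) → Dec (OnCycle y) → x ≡ y
    go (yes (t , ct≡x)) (yes (u , cu≡y)) = trans (sym ct≡x) (trans (cong c (next-injective
      (c-injective (trans (sym (shift-on′ ct≡x)) (trans e (shift-on′ cu≡y)))))) cu≡y)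
    go (yes (t , ct≡x)) (no off) =
      contradiction (next t , trans (sym (shift-on′ ct≡x)) (trans e (shift-off off))) off
    go (no off) (yes (u , cu≡y)) =
      contradiction (next u , trans (sym (shift-on′ cu≡y)) (trans (sym e) (shift-off off))) off
    go (no offx) (no offy) = trans (sym (shift-off offx)) (trans e (shift-off offy))

  shift-surjective : ∀ y → ∃ λ x → shift x ≡ y
  shift-surjective y with onCycle? y
  ... | yes (t , refl) = c (prev t) , trans (shift-on (prev t)) (cong c (next-prev t))
  ... | no  off        = y , shift-off off

  position : Fin n → Fin (suc s)
  position x with onCycle? x
  ... | yes (t , _) = t
  ... | no  _       = zero

  c-position : ∀ {x} → OnCycle x → c (position x) ≡ x
  c-position {x} on with onCycle? x
  ... | yes (_ , ct≡x) = ct≡x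
  ... | no  off        = contradiction on off

  moved⇒onCycle : ∀ {x} → moved shift x ≡ true → OnCycle x
  moved⇒onCycle {x} mx with onCycle? x
  ... | yes on = on
  ... | no off rewrite shift-off off | ==-refl x = contradiction mx λ ()

  count-moved-shift : count (moved shift) ≤ suc s
  count-moved-shift = ≤-trans
    (count-≤-injection {q = λ _ → true} position
      (λ mx my e → trans (sym (c-position (moved⇒onCycle mx)))
                         (trans (cong c e) (c-position (moved⇒onCycle my))))
      (λ _ → refl))
    (≤-reflexive (count-all (λ _ → refl)))

-- Bipartite graphs with a reference perfect matching

fromBiadjacency : (Fin a → Fin b → Bool) → Fin a ⊎ Fin b → Fin a ⊎ Fin b → Bool
fromBiadjacency B (inj₁ i) (inj₂ j) = B i j
fromBiadjacency B (inj₂ j) (inj₁ i) = B i j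
fromBiadjacency B (inj₁ _) (inj₁ _) = false
fromBiadjacency B (inj₂ _) (inj₂ _) = false

fromBiadjacency-sym : (B : Fin a → Fin b → Bool) → ∀ x y → fromBiadjacency B x y ≡ fromBiadjacency B y x
fromBiadjacency-sym B (inj₁ i) (inj₁ j) = refl
fromBiadjacency-sym B (inj₁ i) (inj₂ j) = refl
fromBiadjacency-sym B (inj₂ j) (inj₁ i) = refl
fromBiadjacency-sym B (inj₂ i) (inj₂ j) = refl

fromBiadjacency-irrefl : (B : Fin a → Fin b → Bool) → ∀ x → fromBiadjacency B x x ≡ false
fromBiadjacency-irrefl B (inj₁ i) = refl
fromBiadjacency-irrefl B (inj₂ j) = refl

fromBiadjacency-cong : {B B′ : Fin a → Fin b → Bool} → (∀ i j → B i j ≡ B′ i j) →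
  ∀ x y → fromBiadjacency B x y ≡ fromBiadjacency B′ x y
fromBiadjacency-cong B≗B′ (inj₁ i) (inj₁ j) = refl
fromBiadjacency-cong B≗B′ (inj₁ i) (inj₂ j) = B≗B′ i j
fromBiadjacency-cong B≗B′ (inj₂ j) (inj₁ i) = B≗B′ i j
fromBiadjacency-cong B≗B′ (inj₂ i) (inj₂ j) = refl

fromBiadjacency-bipartite : (B : Fin a → Fin b → Bool) → ∀ x y → fromBiadjacency B x y ≡ true →
  is-just (isInj₁ x) ≢ is-just (isInj₁ y)
fromBiadjacency-bipartite B (inj₁ i) (inj₂ j) _ ()
fromBiadjacency-bipartite B (inj₂ j) (inj₁ i) _ ()

graphOf : (Fin n → Fin n) → Fin n → Fin n → Bool
graphOf σ i j = σ i == j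

count-graphOf-row : (σ : Fin n → Fin n) (i : Fin n) → count (graphOf σ i) ≡ 1
count-graphOf-row σ i = unique⇒count≡1 {p = graphOf σ i} (==-refl (σ i)) (λ e → sym (==⇒≡ e))

count-graphOf-column : {σ : Fin n → Fin n} → Injective _≡_ _≡_ σ → ∀ {i j} → σ i ≡ j →
  count (λ i′ → graphOf σ i′ j) ≡ 1
count-graphOf-column {σ = σ} σ-injective {i} {j} σi≡j =
  unique⇒count≡1 (dec-true (σ i ≟ j) σi≡j) (λ e → σ-injective (trans (==⇒≡ e) (sym σi≡j)))

graphOf-fixed : {σ : Fin n → Fin n} → Injective _≡_ _≡_ σ → ∀ x → σ (reduce x) ≡ reduce x →
  ∀ y → fromBiadjacency (graphOf id) x y ≡ fromBiadjacency (graphOf σ) x y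
graphOf-fixed σ-inj (inj₁ i) fix (inj₁ j) = refl
graphOf-fixed σ-inj (inj₁ i) fix (inj₂ j) =
  does-⇔ (mk⇔ (trans fix) (trans (sym fix))) (i ≟ j) (_ ≟ j)
graphOf-fixed σ-inj (inj₂ j) fix (inj₁ i) =
  does-⇔ (mk⇔ (λ i≡j → trans (cong _ i≡j) fix) (λ σi≡j → σ-inj (trans σi≡j (sym fix)))) (i ≟ j) (_ ≟ j)
graphOf-fixed σ-inj (inj₂ j) fix (inj₂ i) = refl

module Sides (ι : Fin m ↔ (Fin n ⊎ Fin n)) where

  open Inverse ι

  from-injective : Injective _≡_ _≡_ from
  from-injective = Injection.injective (↔⇒↣ (↔-sym ι))

  ℓ r : Fin n → Fin m
  ℓ i = from (inj₁ i)
  r j = from (inj₂ j)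

  ℓ-injective : Injective _≡_ _≡_ ℓ
  ℓ-injective = Sumₚ.inj₁-injective ∘ from-injective

  r-injective : Injective _≡_ _≡_ r
  r-injective = Sumₚ.inj₂-injective ∘ from-injective

  data Side : Fin m → Set where
    left  : ∀ i → Side (ℓ i)
    right : ∀ j → Side (r j)

  side : ∀ x → Side x
  side x = subst Side (strictlyInverseʳ x) (side-from (to x))
    where
    side-from : ∀ a → Side (from a)
    side-from (inj₁ i) = left i
    side-from (inj₂ j) = right j

  lift : (Fin n ⊎ Fin n → Fin n ⊎ Fin n → Bool) → Fin m → Fin m → Bool
  lift R x y = R (to x) (to y)

  lift-from : ∀ R a c → lift R (from a) (from c) ≡ R a c
  lift-from R a c rewrite strictlyInverseˡ a | strictlyInverseˡ c = refl

  count-lift-row : ∀ R a → count (lift R (from a)) ≡ count (R a ∘ inj₁) + count (R a ∘ inj₂)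
  count-lift-row R a = trans (count-⊎ ι (lift R (from a)))
    (cong₂ _+_ (count-cong (lift-from R a ∘ inj₁)) (count-cong (lift-from R a ∘ inj₂)))

  matching : (Fin n → Fin n) → Fin m → Fin m → Bool
  matching σ = lift (fromBiadjacency (graphOf σ))

  matching-sym : ∀ σ x y → matching σ x y ≡ matching σ y x
  matching-sym σ x y = fromBiadjacency-sym (graphOf σ) (to x) (to y)

  matching-ℓr : ∀ σ i j → matching σ (ℓ i) (r j) ≡ (σ i == j)
  matching-ℓr σ i j = lift-from (fromBiadjacency (graphOf σ)) (inj₁ i) (inj₂ j)

  matching-ℓℓ : ∀ σ i j → matching σ (ℓ i) (ℓ j) ≡ false
  matching-ℓℓ σ i j = lift-from (fromBiadjacency (graphOf σ)) (inj₁ i) (inj₁ j)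

  matching-rr : ∀ σ i j → matching σ (r i) (r j) ≡ false
  matching-rr σ i j = lift-from (fromBiadjacency (graphOf σ)) (inj₂ i) (inj₂ j)

  matching-cong : {σ τ : Fin n → Fin n} → (∀ i → σ i ≡ τ i) →
    ∀ x y → matching σ x y ≡ matching τ x y
  matching-cong σ≗τ x y = fromBiadjacency-cong (λ i j → cong (_== j) (σ≗τ i)) (to x) (to y)

  matching-differs : {σ : Fin n → Fin n} {i : Fin n} → σ i ≢ i →
    ¬ (∀ x y → matching id x y ≡ matching σ x y)
  matching-differs {σ} {i} σi≢i same = σi≢i (==⇒≡ (begin
    σ i == i                  ≡⟨ matching-ℓr σ i i ⟨
    matching σ (ℓ i) (r i)    ≡⟨ same (ℓ i) (r i) ⟨
    matching id (ℓ i) (r i)   ≡⟨ matching-ℓr id i i ⟩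
    i == i                    ≡⟨ ==-refl i ⟩
    true                      ∎))
    where open ≡-Reasoning

  matching-rowCount : {σ : Fin n → Fin n} → Injective _≡_ _≡_ σ → (∀ j → ∃ λ i → σ i ≡ j) →
    ∀ x → count (matching σ x) ≡ 1
  matching-rowCount {σ} σ-inj σ-surj x with side x
  ... | left i  = begin
    count (matching σ (ℓ i))
      ≡⟨ count-lift-row (fromBiadjacency (graphOf σ)) (inj₁ i) ⟩
    count {n} (λ _ → false) + count (graphOf σ i)
      ≡⟨ cong₂ _+_ (count-none {n} (λ _ → refl)) (count-graphOf-row σ i) ⟩
    1 ∎
    where open ≡-Reasoning
  ... | right j = begin
    count (matching σ (r j))
      ≡⟨ count-lift-row (fromBiadjacency (graphOf σ)) (inj₂ j) ⟩
    count (λ i → graphOf σ i j) + count {n} (λ _ → false)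
      ≡⟨ cong₂ _+_ (count-graphOf-column σ-inj (proj₂ (σ-surj j))) (count-none {n} (λ _ → refl)) ⟩
    1 ∎
    where open ≡-Reasoning

  -- A pair {ℓ i , r j} is counted at its smaller end ℓ i, and for i moved the row of ℓ i
  -- differs at r i and at r (σ i).
  symDiffSize-matching-lower : (∀ i j → toℕ (ℓ i) < toℕ (r j)) → (σ : Fin n → Fin n) →
    2 * count (moved σ) ≤ symDiffSize (matching id) (matching σ)
  symDiffSize-matching-lower ℓ<r σ = begin
    2 * count (moved σ)
      ≤⟨ *-monoʳ-≤ 2 (count-≤-injection ℓ (λ _ _ → ℓ-injective) two-above) ⟩
    2 * count (λ x → does (2 ≤? above x))
      ≤⟨ *-count≤sumFin 2 above _ (λ x → does⇒ (2 ≤? above x)) ⟩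
    symDiffSize (matching id) (matching σ) ∎
    where
    open ≤-Reasoning
    above : Fin m → ℕ
    above x = count (λ y → ⌊ x <? y ⌋ ∧ (matching id x y xor matching σ x y))
    above-r : ∀ {i} j → matching id (ℓ i) (r j) xor matching σ (ℓ i) (r j) ≡ true →
      (⌊ ℓ i <? r j ⌋ ∧ (matching id (ℓ i) (r j) xor matching σ (ℓ i) (r j))) ≡ true
    above-r {i} j e rewrite trans (isYes≗does (ℓ i <? r j)) (dec-true (ℓ i <? r j) (ℓ<r i j)) = e
    two-above : ∀ {i} → moved σ i ≡ true → does (2 ≤? above (ℓ i)) ≡ true
    two-above {i} mi =
      dec-true (2 ≤? _) (count-≥2 (above-r i old) (above-r (σ i) new) (σi≢i ∘ sym ∘ r-injective))
      where
      σi≢i : σ i ≢ i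
      σi≢i = moved⇒≢ {σ = σ} mi
      old : matching id (ℓ i) (r i) xor matching σ (ℓ i) (r i) ≡ true
      old rewrite matching-ℓr id i i | matching-ℓr σ i i | ==-refl i | ==-false σi≢i = refl
      new : matching id (ℓ i) (r (σ i)) xor matching σ (ℓ i) (r (σ i)) ≡ true
      new rewrite matching-ℓr id i (σ i) | matching-ℓr σ i (σ i) | ==-refl (σ i) | ==-false (σi≢i ∘ sym)
        = refl

  -- Every row differs in at most two places, and a row whose index σ fixes does not differ.
  symDiffSize-matching-upper : {σ : Fin n → Fin n} →
    Injective _≡_ _≡_ σ → (∀ j → ∃ λ i → σ i ≡ j) →
    symDiffSize (matching id) (matching σ) ≤ 2 * count (moved σ)
  symDiffSize-matching-upper {σ} σ-inj σ-surj = *-cancelˡ-≤ 2 (begin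
    2 * symDiffSize (matching id) (matching σ) ≤⟨ handshake-≤ T T-sym ⟩
    sumFin (λ x → count (T x))                 ≤⟨ sumFin≤*-count 2 (λ x → count (T x)) Q row≤2 row≡0 ⟩
    2 * count Q                                ≡⟨ cong (2 *_) count-Q ⟩
    2 * (2 * count (moved σ))                  ∎)
    where
    open ≤-Reasoning
    T : Fin m → Fin m → Bool
    T x y = matching id x y xor matching σ x y
    T-sym : ∀ x y → T x y ≡ T y x
    T-sym x y = cong₂ _xor_ (matching-sym id x y) (matching-sym σ x y)
    Q : Fin m → Bool
    Q x = moved σ (reduce (to x))
    count-Q : count Q ≡ 2 * count (moved σ)
    count-Q = trans (count-⊎ ι Q) (trans
      (cong₂ _+_ (count-cong (λ i → cong (moved σ ∘ reduce) (strictlyInverseˡ (inj₁ i))))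
                 (count-cong (λ j → cong (moved σ ∘ reduce) (strictlyInverseˡ (inj₂ j)))))
      (cong (count (moved σ) +_) (sym (+-identityʳ _))))
    row≤2 : ∀ x → count (T x) ≤ 2
    row≤2 x = begin
      count (T x)
        ≤⟨ count-mono (λ y e → ∧-conicalˡ _ _ (trans (sym (xor-is-ok (matching id x y) _)) e)) ⟩
      count (λ y → matching id x y ∨ matching σ x y)
        ≤⟨ count-∨-≤ (matching id x) (matching σ x) ⟩
      count (matching id x) + count (matching σ x)
        ≡⟨ cong₂ _+_ (matching-rowCount (λ e → e) (λ j → j , refl) x) (matching-rowCount σ-inj σ-surj x) ⟩
      2 ∎
    row≡0 : ∀ x → Q x ≡ false → count (T x) ≡ 0
    row≡0 x ¬Qx = count-none (λ y → trans
      (cong (_xor matching σ x y) (graphOf-fixed σ-inj (to x) (¬moved⇒fixed {σ = σ} ¬Qx) (to y)))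
      (xor-same (matching σ x y)))

  module MatchedGraph (G : Graph m)
                      (ℓℓ : ∀ i j → adj G (ℓ i) (ℓ j) ≡ false)
                      (rr : ∀ i j → adj G (r i) (r j) ≡ false)
                      (ℓr : ∀ i → adj G (ℓ i) (r i) ≡ true) where

    D : Digraph n
    D i j = adj G (ℓ i) (r j) ∧ not (j == i)

    deg-ℓ : ∀ i → deg G (ℓ i) ≡ suc (outdeg D i)
    deg-ℓ i = begin
      deg G (ℓ i)
        ≡⟨ count-⊎ ι (adj G (ℓ i)) ⟩
      count (λ j → adj G (ℓ i) (ℓ j)) + count (λ j → adj G (ℓ i) (r j))
        ≡⟨ cong (_+ count (λ j → adj G (ℓ i) (r j))) (count-none {p = λ j → adj G (ℓ i) (ℓ j)} (ℓℓ i)) ⟩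
      count (λ j → adj G (ℓ i) (r j))
        ≡⟨ count-remove (λ j → adj G (ℓ i) (r j)) (ℓr i) ⟩
      suc (outdeg D i) ∎
      where open ≡-Reasoning

    deg-r : ∀ j → deg G (r j) ≡ suc (indeg D j)
    deg-r j = begin
      deg G (r j)
        ≡⟨ count-⊎ ι (adj G (r j)) ⟩
      count (λ i → adj G (r j) (ℓ i)) + count (λ i → adj G (r j) (r i))
        ≡⟨ cong₂ _+_ (count-cong (λ i → Graph.sym G (r j) (ℓ i))) (count-none {p = λ i → adj G (r j) (r i)} (rr j)) ⟩
      count (λ i → adj G (ℓ i) (r j)) + 0
        ≡⟨ +-identityʳ _ ⟩
      count (λ i → adj G (ℓ i) (r j))
        ≡⟨ count-remove (λ i → adj G (ℓ i) (r j)) (ℓr j) ⟩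
      suc (count (remove (λ i → adj G (ℓ i) (r j)) j))
        ≡⟨ cong suc (count-cong (λ i → cong (λ b → adj G (ℓ i) (r j) ∧ not b) (==-sym i j))) ⟩
      suc (indeg D j) ∎
      where open ≡-Reasoning

    matching-perfect : {σ : Fin n → Fin n} → Injective _≡_ _≡_ σ → (∀ j → ∃ λ i → σ i ≡ j) →
      (∀ i → adj G (ℓ i) (r (σ i)) ≡ true) → IsPerfectMatching G (matching σ)
    matching-perfect {σ} σ-inj σ-surj edge = matching-sym σ , ⊆adj , matching-rowCount σ-inj σ-surj
      where
      ⊆adj-ℓr : ∀ i j → matching σ (ℓ i) (r j) ≡ true → adj G (ℓ i) (r j) ≡ true
      ⊆adj-ℓr i j e =
        subst (λ j → adj G (ℓ i) (r j) ≡ true) (==⇒≡ (trans (sym (matching-ℓr σ i j)) e)) (edge i)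
      ⊆adj : ∀ x y → matching σ x y ≡ true → adj G x y ≡ true
      ⊆adj x y e with side x | side y
      ... | left i  | left j  = contradiction (trans (sym e) (matching-ℓℓ σ i j)) λ ()
      ... | left i  | right j = ⊆adj-ℓr i j e
      ... | right j | left i  =
        trans (Graph.sym G (r j) (ℓ i)) (⊆adj-ℓr i j (trans (matching-sym σ (ℓ i) (r j)) e))
      ... | right i | right j = contradiction (trans (sym e) (matching-rr σ i j)) λ ()

    module PerfectMatching {M : Fin m → Fin m → Bool} (M-pm : IsPerfectMatching G M) where

      M-sym : ∀ x y → M x y ≡ M y x
      M-sym = proj₁ M-pm

      M⊆adj : ∀ x y → M x y ≡ true → adj G x y ≡ true
      M⊆adj = proj₁ (proj₂ M-pm)

      M-rows : ∀ x → count (M x) ≡ 1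
      M-rows = proj₂ (proj₂ M-pm)

      M-false : ∀ {x y} → adj G x y ≡ false → M x y ≡ false
      M-false {x} {y} ¬xy with M x y in e
      ... | true  = contradiction (trans (sym (M⊆adj x y e)) ¬xy) λ ()
      ... | false = refl

      row-r : ∀ i → count (λ j → M (ℓ i) (r j)) ≡ 1
      row-r i = begin
        count (λ j → M (ℓ i) (r j))
          ≡⟨ cong (_+ count (λ j → M (ℓ i) (r j))) (count-none {p = λ j → M (ℓ i) (ℓ j)} (M-false ∘ ℓℓ i)) ⟨
        count (λ j → M (ℓ i) (ℓ j)) + count (λ j → M (ℓ i) (r j))
          ≡⟨ count-⊎ ι (M (ℓ i)) ⟨
        count (M (ℓ i))
          ≡⟨ M-rows (ℓ i) ⟩
        1 ∎
        where open ≡-Reasoning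

      σ : Fin n → Fin n
      σ i = proj₁ (count≡1⇒∃ {p = λ j → M (ℓ i) (r j)} (row-r i))

      σ-edge : ∀ i → M (ℓ i) (r (σ i)) ≡ true
      σ-edge i = proj₂ (count≡1⇒∃ {p = λ j → M (ℓ i) (r j)} (row-r i))

      σ-unique : ∀ {i j} → M (ℓ i) (r j) ≡ true → σ i ≡ j
      σ-unique {i} e = count≡1⇒unique (row-r i) (σ-edge i) e

      σ-injective : Injective _≡_ _≡_ σ
      σ-injective {i} {i′} σi≡σi′ = ℓ-injective (count≡1⇒unique (M-rows (r (σ i)))
        (trans (M-sym _ _) (σ-edge i))
        (trans (M-sym _ _) (subst (λ j → M (ℓ i′) (r j) ≡ true) (sym σi≡σi′) (σ-edge i′))))

      M-ℓr : ∀ i j → M (ℓ i) (r j) ≡ (σ i == j)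
      M-ℓr i j with σ i ≟ j
      ... | yes refl = σ-edge i
      ... | no σi≢j with M (ℓ i) (r j) in e
      ...   | true  = contradiction (σ-unique e) σi≢j
      ...   | false = refl

      M≗matching : ∀ x y → M x y ≡ matching σ x y
      M≗matching x y with side x | side y
      ... | left i  | left j  = trans (M-false (ℓℓ i j)) (sym (matching-ℓℓ σ i j))
      ... | left i  | right j = trans (M-ℓr i j) (sym (matching-ℓr σ i j))
      ... | right j | left i  =
        trans (M-sym _ _) (trans (M-ℓr i j) (sym (trans (matching-sym σ _ _) (matching-ℓr σ i j))))
      ... | right i | right j = trans (M-false (rr i j)) (sym (matching-rr σ i j))

      nearby⇒equal⊎cycle : (∀ i j → toℕ (ℓ i) < toℕ (r j)) →
        ∀ {k} → symDiffSize (matching id) M ≤ 2 * k →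
        (∀ x y → matching id x y ≡ M x y) ⊎ (∃ λ L → suc L ≤ k × DirectedCycle D L)
      nearby⇒equal⊎cycle ℓ<r near with Finₚ.all? (λ i → σ i ≟ i)
      ... | yes fixed = inj₁ (λ x y → trans (matching-cong (sym ∘ fixed) x y) (sym (M≗matching x y)))
      ... | no ¬fixed =
        let i₀ , σi₀≢i₀ = Finₚ.¬∀⟶∃¬ n _ (λ i → σ i ≟ i) ¬fixed
            L , L<moved , cycle = Orbit.orbit-cycle σ-injective i₀ D arc σi₀≢i₀
        in inj₂ (L , ≤-trans L<moved (*-cancelˡ-≤ 2 (≤-trans moved-lower near)) , cycle)
        where
        arc : ∀ i → σ i ≢ i → D i (σ i) ≡ true
        arc i σi≢i rewrite ==-false σi≢i = trans (∧-identityʳ _) (M⊆adj _ _ (σ-edge i))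
        moved-lower : 2 * count (moved σ) ≤ symDiffSize (matching id) M
        moved-lower = ≤-trans (symDiffSize-matching-lower ℓ<r σ)
          (≤-reflexive (symDiffSize-cong {M₁ = matching id} (λ _ _ → refl) (λ x y → sym (M≗matching x y))))

    cycle⇒nearby-matching : ∀ {L} → DirectedCycle D (suc L) →
      ∃ λ M → IsPerfectMatching G M × symDiffSize (matching id) M ≤ 2 * suc (suc L) ×
              ¬ (∀ x y → matching id x y ≡ M x y)
    cycle⇒nearby-matching cyc@(c , c-injective , _) =
      matching shift ,
      matching-perfect {σ = shift} shift-injective shift-surjective edge ,
      ≤-trans (symDiffSize-matching-upper {σ = shift} shift-injective shift-surjective)
              (*-monoʳ-≤ 2 count-moved-shift) ,
      matching-differs {σ = shift} c₀-moved
      where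
      open CyclicShift c c-injective
      edge : ∀ i → adj G (ℓ i) (r (shift i)) ≡ true
      edge i = edge-by (onCycle? i)
        where
        edge-by : Dec (OnCycle i) → adj G (ℓ i) (r (shift i)) ≡ true
        edge-by (yes (t , ct≡i)) =
          subst₂ (λ x y → adj G (ℓ x) (r y) ≡ true) ct≡i (sym (shift-on′ ct≡i))
                 (∧-conicalˡ _ _ (cycle-arc {A = D} cyc t))
        edge-by (no off) = subst (λ j → adj G (ℓ i) (r j) ≡ true) (sym (shift-off off)) (ℓr i)
      c₀-moved : shift (c zero) ≢ c zero
      c₀-moved e = Finₚ.0≢1+n (c-injective (sym (trans (sym (shift-on zero)) e)))

-- 2 * n normalises to n + (n + 0).
halves : (n : ℕ) → Fin (2 * n) ↔ (Fin n ⊎ Fin n)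
halves n = subst (λ k → Fin (2 * n) ↔ (Fin n ⊎ Fin k)) (+-identityʳ n) +↔⊎

+↔⊎-ordered : ∀ {a b c} (b≡c : b ≡ c) (i : Fin a) (j : Fin c) →
  let ι = subst (λ k → Fin (a + b) ↔ (Fin a ⊎ Fin k)) b≡c +↔⊎ in
  toℕ (Inverse.from ι (inj₁ i)) < toℕ (Inverse.from ι (inj₂ j))
+↔⊎-ordered {a} {b} refl i j = begin-strict
  toℕ (i ↑ˡ b)   ≡⟨ Finₚ.toℕ-↑ˡ i b ⟩
  toℕ i          <⟨ Finₚ.toℕ<n i ⟩
  a              ≤⟨ m≤m+n a (toℕ j) ⟩
  a + toℕ j      ≡⟨ Finₚ.toℕ-↑ʳ a j ⟨
  toℕ (a ↑ʳ j)   ∎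
  where open ≤-Reasoning

orientedGraph⇒bipartiteGraph : ∀ {k d n} (A : Digraph n) → (∀ v → A v v ≡ false) → MinSemidegree A d →
  NoShortCycle A k → Σ (Graph (2 * n)) λ G → IsBipartite G × MinDegree G (d + 1) × HkHasIsolatedVertex k G
orientedGraph⇒bipartiteGraph {k} {d} {n} A A-irrefl (semidegree , v₀ , v₀-tight) acyclic =
  G , bipartite , (deg≥ , tight) , matching id , M₀-perfect , isolated
  where
  open Sides (halves n)
  open Inverse (halves n) using (to)
  B : Fin n → Fin n → Bool
  B i j = (i == j) ∨ A i j
  G : Graph (2 * n)
  G = record { adj    = lift (fromBiadjacency B)
             ; sym    = λ x y → fromBiadjacency-sym B (to x) (to y)
             ; irrefl = λ x → fromBiadjacency-irrefl B (to x) }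
  ℓr : ∀ i → adj G (ℓ i) (r i) ≡ true
  ℓr i = trans (lift-from (fromBiadjacency B) (inj₁ i) (inj₂ i)) (cong (_∨ A i i) (==-refl i))
  open MatchedGraph G (λ i j → lift-from (fromBiadjacency B) (inj₁ i) (inj₁ j))
                      (λ i j → lift-from (fromBiadjacency B) (inj₂ i) (inj₂ j)) ℓr
  D≗A : ∀ i j → D i j ≡ A i j
  D≗A i j rewrite lift-from (fromBiadjacency B) (inj₁ i) (inj₂ j) with i ≟ j
  ... | yes refl rewrite ==-refl i | A-irrefl i = refl
  ... | no i≢j   rewrite ==-false (i≢j ∘ sym) = ∧-identityʳ _
  bipartite : IsBipartite G
  bipartite = (λ x → is-just (isInj₁ (to x))) , λ x y → fromBiadjacency-bipartite B (to x) (to y)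
  deg-ℓ′ : ∀ i → deg G (ℓ i) ≡ suc (outdeg A i)
  deg-ℓ′ i = trans (deg-ℓ i) (cong suc (count-cong (D≗A i)))
  deg-r′ : ∀ j → deg G (r j) ≡ suc (indeg A j)
  deg-r′ j = trans (deg-r j) (cong suc (count-cong (λ i → D≗A i j)))
  deg≥ : ∀ x → d + 1 ≤ deg G x
  deg≥ x with side x
  ... | left i  rewrite deg-ℓ′ i | +-comm d 1 = s≤s (proj₁ (semidegree i))
  ... | right j rewrite deg-r′ j | +-comm d 1 = s≤s (proj₂ (semidegree j))
  tight : ∃ λ x → deg G x ≡ d + 1
  tight = [ (λ out≡d → ℓ v₀ , trans (deg-ℓ′ v₀) (trans (cong suc out≡d) (+-comm 1 d)))
          , (λ in≡d  → r v₀ , trans (deg-r′ v₀) (trans (cong suc in≡d) (+-comm 1 d))) ]′ v₀-tight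
  M₀-perfect : IsPerfectMatching G (matching id)
  M₀-perfect = matching-perfect (λ e → e) (λ j → j , refl) ℓr
  isolated : ∀ M → IsPerfectMatching G M → symDiffSize (matching id) M ≤ 2 * k →
    ∀ x y → matching id x y ≡ M x y
  isolated M M-pm near with PerfectMatching.nearby⇒equal⊎cycle M-pm (+↔⊎-ordered (+-identityʳ n)) near
  ... | inj₁ same              = same
  ... | inj₂ (L , L<k , cycle) = ⊥-elim (acyclic L L<k (cycle-⊆ (λ i j → subst (_≡ true) (D≗A i j)) cycle))

module ColourClasses (col : Fin m → Bool) (mate : Fin m → Fin m)
                     (mate-involutive : ∀ x → mate (mate x) ≡ x)
                     (mate-col : ∀ x → col (mate x) ≡ not (col x)) where

  private
    mate-false : ∀ {x} → col x ≡ false → col (mate x) ≡ true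
    mate-false {x} e = trans (mate-col x) (cong not e)

    split : (x : Fin m) (b : Bool) → col x ≡ b → Fin (count col) ⊎ Fin (count col)
    split x true  e = inj₁ (rank col x e)
    split x false e = inj₂ (rank col (mate x) (mate-false e))

    merge : Fin (count col) ⊎ Fin (count col) → Fin m
    merge = [ enum col , mate ∘ enum col ]′

    split-true : ∀ {x} b (e : col x ≡ b) (e′ : col x ≡ true) → split x b e ≡ inj₁ (rank col x e′)
    split-true true  e e′ = cong inj₁ (rank-cong col refl e e′)
    split-true false e e′ = contradiction (trans (sym e′) e) λ ()

    split-false : ∀ {x} b (e : col x ≡ b) (e′ : col x ≡ false) →
      split x b e ≡ inj₂ (rank col (mate x) (mate-false e′))
    split-false true  e e′ = contradiction (trans (sym e) e′) λ ()
    split-false false e e′ = cong inj₂ (rank-cong col refl _ _)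

    merge-split : ∀ x b (e : col x ≡ b) → merge (split x b e) ≡ x
    merge-split x true  e = enum-rank col x e
    merge-split x false e = trans (cong mate (enum-rank col (mate x) (mate-false e))) (mate-involutive x)

    split-merge : ∀ a → split (merge a) _ refl ≡ a
    split-merge (inj₁ i) = trans (split-true _ refl (enum-true col i)) (cong inj₁ (rank-enum col i _))
    split-merge (inj₂ i) = trans (split-false _ refl (trans (mate-col _) (cong not (enum-true col i))))
      (cong inj₂ (trans (rank-cong col (mate-involutive _) _ (enum-true col i)) (rank-enum col i _)))

  colourClasses : Fin m ↔ (Fin (count col) ⊎ Fin (count col))
  colourClasses = mk↔ₛ′ (λ x → split x (col x) refl) merge split-merge (λ x → merge-split x (col x) refl)

bipartiteGraph⇒orientedGraph : ∀ {k d n} → 2 ≤ k → (G : Graph (2 * n)) → IsBipartite G →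
  MinDegree G (d + 1) → HkHasIsolatedVertex k G →
  Σ (Digraph n) λ A → IsOriented A × MinSemidegree A d × NoShortCycle A k
bipartiteGraph⇒orientedGraph {k} {d} {n} 2≤k G (col , proper) (deg≥ , x₀ , x₀-tight)
                             (M , M-pm@(M-sym , M⊆adj , M-rows) , isolated) =
  -- D is built on an enumeration of one colour class, which c≡n identifies with Fin n.
  subst (λ c → Σ (Digraph c) λ A → IsOriented A × MinSemidegree A d × NoShortCycle A k) c≡n
    (D , (D-irrefl , D-asym) , (semidegree , tight) , acyclic)
  where
  mate : Fin (2 * n) → Fin (2 * n)
  mate x = proj₁ (count≡1⇒∃ {p = M x} (M-rows x))
  M-mate : ∀ x → M x (mate x) ≡ true
  M-mate x = proj₂ (count≡1⇒∃ {p = M x} (M-rows x))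
  mate-involutive : ∀ x → mate (mate x) ≡ x
  mate-involutive x = count≡1⇒unique (M-rows (mate x)) (M-mate (mate x)) (trans (M-sym _ _) (M-mate x))
  mate-col : ∀ x → col (mate x) ≡ not (col x)
  mate-col x = ¬-not (λ e → proper x (mate x) (M⊆adj _ _ (M-mate x)) (sym e))
  open ColourClasses col mate mate-involutive mate-col
  open Sides colourClasses
  ℓ-col : ∀ i → col (ℓ i) ≡ true
  ℓ-col = enum-true col
  r-col : ∀ i → col (r i) ≡ false
  r-col i = trans (mate-col (ℓ i)) (cong not (ℓ-col i))
  same-colour⇒¬adj : ∀ {x y} → col x ≡ col y → adj G x y ≡ false
  same-colour⇒¬adj {x} {y} e with adj G x y in xy
  ... | true  = contradiction e (proper x y xy)
  ... | false = refl
  open MatchedGraph G (λ i j → same-colour⇒¬adj (trans (ℓ-col i) (sym (ℓ-col j))))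
                      (λ i j → same-colour⇒¬adj (trans (r-col i) (sym (r-col j))))
                      (λ i → M⊆adj _ _ (M-mate (ℓ i)))
  c≡n : count col ≡ n
  c≡n = *-cancelˡ-≡ (count col) n 2 (trans (cong (count col +_) (+-identityʳ _)) (begin
    count col + count col                       ≡⟨ cong₂ _+_ all-true all-true ⟨
    count {count col} (λ _ → true) + count {count col} (λ _ → true)
                                                ≡⟨ count-⊎ colourClasses (λ _ → true) ⟨
    count {2 * n} (λ _ → true)                  ≡⟨ count-all (λ _ → refl) ⟩
    2 * n                                       ∎))
    where
    open ≡-Reasoning
    all-true : count {count col} (λ _ → true) ≡ count col
    all-true = count-all (λ _ → refl)
  M≗M₀ : ∀ x y → M x y ≡ matching id x y
  M≗M₀ x y = trans (M≗matching x y) (matching-cong (λ i → σ-unique (M-mate (ℓ i))) x y)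
    where open PerfectMatching M-pm
  D-irrefl : ∀ v → D v v ≡ false
  D-irrefl v rewrite ==-refl v = ∧-zeroʳ _
  no-short-cycle : ∀ L → suc (suc L) ≤ k → DirectedCycle D (suc L) → ⊥
  no-short-cycle L L+2≤k cycle with cycle⇒nearby-matching cycle
  ... | M′ , M′-pm , near , differs =
    differs λ x y → trans (sym (M≗M₀ x y)) (isolated M′ M′-pm near′ x y)
    where
    near′ : symDiffSize M M′ ≤ 2 * k
    near′ = ≤-trans (≤-reflexive (symDiffSize-cong {M₂ = M′} M≗M₀ (λ _ _ → refl)))
                    (≤-trans near (*-monoʳ-≤ 2 L+2≤k))
  D-asym : ∀ u v → D u v ≡ true → D v u ≡ false
  D-asym u v uv with D v u in vu
  ... | true  = ⊥-elim (no-short-cycle 0 2≤k (2-cycle {A = D} u≢v uv vu))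
    where
    u≢v : u ≢ v
    u≢v refl = contradiction (trans (sym uv) (D-irrefl u)) λ ()
  ... | false = refl
  acyclic : NoShortCycle D k
  acyclic zero    _ (c , _ , _ , last) = contradiction (trans (sym last) (D-irrefl (c zero))) λ ()
  acyclic (suc L) = no-short-cycle L
  semidegree : ∀ v → (d ≤ outdeg D v) × (d ≤ indeg D v)
  semidegree v = s≤s⁻¹ (subst₂ _≤_ (+-comm d 1) (deg-ℓ v) (deg≥ (ℓ v)))
               , s≤s⁻¹ (subst₂ _≤_ (+-comm d 1) (deg-r v) (deg≥ (r v)))
  tight : ∃ λ v → (outdeg D v ≡ d) ⊎ (indeg D v ≡ d)
  tight with side x₀
  ... | left i  = i , inj₁ (suc-injective (trans (sym (deg-ℓ i)) (trans x₀-tight (+-comm d 1))))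
  ... | right j = j , inj₂ (suc-injective (trans (sym (deg-r j)) (trans x₀-tight (+-comm d 1))))

theorem6p2 : (k d n : ℕ) → 2 ≤ k → 1 ≤ n →
    (Σ (Digraph n) λ A → IsOriented A × MinSemidegree A d × NoShortCycle A k)
    ⇔
    (Σ (Graph (2 * n)) λ G → IsBipartite G × MinDegree G (d + 1) × HkHasIsolatedVertex k G)
theorem6p2 k d n 2≤k _ = mk⇔
  (λ (A , (A-irrefl , _) , semidegree , acyclic) →
     orientedGraph⇒bipartiteGraph A A-irrefl semidegree acyclic)
  (λ (G , bipartite , minDegree , isolated) →
     bipartiteGraph⇒orientedGraph 2≤k G bipartite minDegree isolated)
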